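{- Let $H$ be an $E$-free graph and let $x,y \in V(H)$ be distinct. If $d_x(y) > 0$ and $d_y(x) > 0$, then $d_x(y) = d_y(x) = 1$. Equivalently, if $d_y(x) \geq 2$ then $d_x(y) = 0$.
   Context: A $2\to1$ directed hypergraph (here simply a "graph") is a pair $H=(V,E)$ with $V$ a finite vertex set and $E$ a set of edges, each edge being a 3-element subset $\{a,b,c\}$ of $V$ with one element marked as the head; the edge with underlying set $\{a,b,c\}$ and head $c$ is written $ab \to c$. A triple may carry up to three distinct edges. A homomorphism $\phi:F\to G$ is a map $V(F)\to V(G)$ with $ab\to c\in E(F)\Rightarrow \phi(a)\phi(b)\to\phi(c)\in E(G)$; $G$ is $F$-free if there is no injective homomorphism $F\to G$. The Escher graph $E$ has vertex set $\{a,b,c,d\}$ and edge set $\{ab\to c,\ cd\to b\}$. For $x\in V(H)$, the tail link graph $T_x$ is the simple undirected graph on $V(H)\setminus\{x\}$ whose edges are the pairs $yz$ with $yz\to x\in E(H)$; for $y\neq x$, $d_x(y)$ denotes the degree of $y$ in $T_x$, i.e. the number of vertices $z$ with $yz\to x\in E(H)$. -}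

module Defs where

open import Data.Nat using (ℕ)
open import Data.Fin using (Fin)
open import Data.List using (length; filter; allFin)
open import Data.Product using (_×_)
open import Relation.Nullary using (¬_; Dec)
open import Relation.Binary.PropositionalEquality using (_≡_; _≢_)

-- A 2→1 directed hypergraph on vertex set Fin n.
-- Edge ab → c is represented by  Edge a b c  (tails a,b ; head c).
-- Each edge lives on a 3-element set, so a,b,c are pairwise distinct,
-- and the tail pair is unordered, so  Edge a b c  and  Edge b a c  coincide.
record Graph (n : ℕ) : Set₁ where
  field
    Edge     : Fin n → Fin n → Fin n → Set
    Edge?    : ∀ a b c → Dec (Edge a b c)
    tail-sym : ∀ {a b c} → Edge a b c → Edge b a c
    distinct : ∀ {a b c} → Edge a b c → (a ≢ b) × (a ≢ c) × (b ≢ c)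
open Graph public

-- H is E-free: there is no injective homomorphism from the Escher graph
-- ({a,b,c,d}, {ab → c, cd → b}), i.e. no pairwise distinct a,b,c,d
-- with ab → c and cd → b.
EscherFree : ∀ {n} → Graph n → Set
EscherFree H = ∀ a b c d →
  a ≢ b → a ≢ c → a ≢ d → b ≢ c → b ≢ d → c ≢ d →
  ¬ (Edge H a b c × Edge H c d b)

-- d_x(y) : degree of y in the tail link graph T_x,
-- i.e. the number of vertices z with  yz → x.
deg : ∀ {n} → Graph n → Fin n → Fin n → ℕ
deg H x y = length (filter (λ z → Edge? H y z x) (allFin _))

module Submission where

-- Suppose  x w → y  and  y z → x  are edges.  If z ≠ w, then the
-- four vertices z, y, x, w are pairwise distinct (all other distinctness
-- comes from the two edges themselves), and  zy → x,  xw → y  is a copy of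
-- the Escher graph.  Hence in an E-free graph, once  d_y(x) > 0  is witnessed
-- by some w, every z with  yz → x  equals w, so  d_x(y) ≤ 1.  Combined with
-- d_x(y) > 0 this gives  d_x(y) = 1, and the symmetric argument gives d_y(x) = 1.

open import Defs
open import Data.Nat using (_>_; _≤_; s≤s; z≤n)
open import Data.Nat.Properties using (≤-antisym)
open import Data.Fin using (Fin; _≟_)
open import Data.Product using (_×_; _,_; ∃)
open import Data.List using (List; []; _∷_; length; filter; allFin)
open import Data.List.Relation.Unary.All using (All; _∷_)
import Data.List.Relation.Unary.All as All
open import Data.List.Relation.Unary.All.Properties using (all-filter)
open import Data.List.Relation.Unary.AllPairs using (_∷_)
open import Data.List.Relation.Unary.Unique.Propositional using (Unique)
import Data.List.Relation.Unary.Unique.Propositional.Properties as Unique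
open import Relation.Binary.PropositionalEquality using (_≡_; _≢_; sym; trans)
open import Relation.Nullary using (yes; no)
open import Relation.Unary using (Pred; Decidable)
open import Data.Empty using (⊥-elim)
open import Function using (_∘_)

witness : ∀ {A : Set} {ℓ} {P : Pred A ℓ} (xs : List A) →
          All P xs → length xs > 0 → ∃ P
witness (a ∷ _) (pa ∷ _) _ = a , pa

unique-constant-length≤1 : ∀ {A : Set} {w : A} (xs : List A) →
                           All (_≡ w) xs → Unique xs → length xs ≤ 1
unique-constant-length≤1 []          _            _                 = z≤n
unique-constant-length≤1 (_ ∷ [])    _            _                 = s≤s z≤n
unique-constant-length≤1 (a ∷ b ∷ _) (a≡w ∷ b≡w ∷ _) ((a≢b ∷ _) ∷ _) =
  ⊥-elim (a≢b (trans a≡w (sym b≡w)))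

filter-length≤1 : ∀ {A : Set} {ℓ} {P : Pred A ℓ} (P? : Decidable P) {w : A} →
                  (∀ z → P z → z ≡ w) →
                  (xs : List A) → Unique xs → length (filter P? xs) ≤ 1
filter-length≤1 P? only-w xs xs-unique =
  unique-constant-length≤1 (filter P? xs)
    (All.map (λ {z} → only-w z) (all-filter P? xs))
    (Unique.filter⁺ P? xs-unique)

deg-witness : ∀ {n} (H : Graph n) (x y : Fin n) →
              deg H x y > 0 → ∃ λ z → Edge H y z x
deg-witness {n} H x y pos =
  witness (filter (λ z → Edge? H y z x) (allFin n))
          (all-filter (λ z → Edge? H y z x) (allFin n)) pos

deg≤1 : ∀ {n} (H : Graph n) (x y w : Fin n) →
        (∀ z → Edge H y z x → z ≡ w) → deg H x y ≤ 1
deg≤1 {n} H x y w only-w =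
  filter-length≤1 (λ z → Edge? H y z x) only-w (allFin n) (Unique.allFin⁺ n)

-- The Escher step: in an E-free graph, edges  xw → y  and  yz → x  force z = w,
-- since otherwise  zy → x,  xw → y  on distinct z, y, x, w is a copy of E.
escher-partner : ∀ {n} (H : Graph n) → EscherFree H → {x y z w : Fin n} →
                 Edge H x w y → Edge H y z x → z ≡ w
escher-partner H E-free {x} {y} {z} {w} xw→y yz→x with z ≟ w
... | yes z≡w = z≡w
... | no  z≢w =
  let (y≢z , y≢x , z≢x) = distinct H yz→x
      (x≢w , _   , w≢y) = distinct H xw→y
  in ⊥-elim (E-free z y x w (y≢z ∘ sym) z≢x z≢w y≢x (w≢y ∘ sym) x≢w
                    (tail-sym H yz→x , xw→y))

deg≡1 : ∀ {n} (H : Graph n) → EscherFree H → (x y : Fin n) →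
        deg H x y > 0 → deg H y x > 0 → deg H x y ≡ 1
deg≡1 H E-free x y dxy>0 dyx>0 =
  let (w , xw→y) = deg-witness H y x dyx>0
  in ≤-antisym (deg≤1 H x y w (λ z → escher-partner H E-free xw→y)) dxy>0

lemma1 : ∀ {n} (H : Graph n) → EscherFree H → (x y : Fin n) → x ≢ y →
         deg H x y > 0 → deg H y x > 0 → (deg H x y ≡ 1 × deg H y x ≡ 1)
lemma1 H E-free x y _ dxy>0 dyx>0 =
  deg≡1 H E-free x y dxy>0 dyx>0 , deg≡1 H E-free y x dyx>0 dxy>0
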